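{- Under the standing assumptions below, the following hold: (1) $r>\sqrt{2}\,p^{d/2}$; (2) $\frac{r}{2}$ divides $\gcd(c_{1},\dots,c_{m},p^{d}-1)$, where $c_1,\dots,c_m$ are the lengths of the $G_{0}$-orbits on $V^{\ast}=V\setminus\{0\}$.
   Context: Standing assumptions: $\mathcal{D}=(\mathcal P,\mathcal B)$ is a non-trivial $2$-$(v,k,2)$ design (any two distinct points lie in exactly $2$ blocks, blocks have size $k$, $2<k<v$), with replication number $r$ (number of blocks through a point, so $r(k-1)=2(v-1)$). $G\le \mathrm{Aut}(\mathcal D)$ is flag-transitive (transitive on incident point–block pairs) and point-primitive, and the socle $T$ of $G$ is an elementary abelian $p$-group ($p$ prime) acting regularly on points. Thus $\mathcal P$ is identified with $V=V_d(p)=GF(p)^d$, $T$ is the translation group of $V$, $v=p^d$, and $G=T:G_0\le AGL_d(p)$, where $G_0$ is the stabilizer of the zero vector and acts irreducibly on $V$. Moreover $r$ is assumed to be even. -}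

module Defs where

open import Data.Nat using (ℕ; zero; suc; _+_; _*_; _∸_; _^_; NonZero)
open import Data.Nat.DivMod using (_mod_)
open import Data.Nat.GCD using (gcd)
open import Data.Fin using (Fin; toℕ)
import Data.Fin as F
open import Data.Vec as V using (Vec; []; _∷_)
open import Data.Vec.Properties using (≡-dec)
open import Data.List as L using (List; []; _∷_; concatMap; allFin; filterᵇ; length)
open import Data.Bool.ListAction using (any)
open import Data.List.Membership.Propositional using (_∈_)
open import Data.List.Relation.Unary.Any using (Any)
open import Data.Bool using (Bool; true; false; not; _∧_)
open import Data.Product using (Σ; ∃; _×_; _,_)
open import Data.Sum using (_⊎_)
open import Relation.Nullary using (¬_)
open import Relation.Nullary.Decidable using (⌊_⌋)
open import Relation.Binary.PropositionalEquality using (_≡_)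
open import Function.Definitions using (Bijective)

count : {A : Set} → (A → Bool) → List A → ℕ
count P xs = length (filterᵇ P xs)

gcdList : ℕ → List ℕ → ℕ
gcdList n []       = n
gcdList n (c ∷ cs) = gcd c (gcdList n cs)

module _ (p : ℕ) .{{_ : NonZero p}} where

  _+ₚ_ : Fin p → Fin p → Fin p
  a +ₚ b = (toℕ a + toℕ b) mod p

  _*ₚ_ : Fin p → Fin p → Fin p
  a *ₚ b = (toℕ a * toℕ b) mod p

  zeroₚ : Fin p
  zeroₚ = 0 mod p

  module _ (d : ℕ) where

    Vect : Set
    Vect = Vec (Fin p) d

    vadd : Vect → Vect → Vect
    vadd = V.zipWith _+ₚ_

    smul : Fin p → Vect → Vect
    smul c = V.map (c *ₚ_)

    zeroV : Vect
    zeroV = V.replicate d zeroₚ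

    _≟V_ : (x y : Vect) → Relation.Nullary.Dec (x ≡ y)
    _≟V_ = ≡-dec F._≟_

    aff : (Vect → Vect) → Vect → Vect → Vect
    aff g t x = vadd (g x) t

  allVecs : (d : ℕ) → List (Vect d)
  allVecs zero    = [] ∷ []
  allVecs (suc d) = concatMap (λ a → L.map (a ∷_) (allVecs d)) (allFin p)

  module _ (d : ℕ) where

    nonzeroVecs : List (Vect d)
    nonzeroVecs = filterᵇ (λ x → not ⌊ _≟V_ d x (zeroV d) ⌋) (allVecs d)

    DistinctBlocks : (b : ℕ) → (Fin b → Vect d → Bool) → Set
    DistinctBlocks b B = ∀ i j → (∀ x → B i x ≡ B j x) → i ≡ j

    blockSize : {b : ℕ} → (Fin b → Vect d → Bool) → Fin b → ℕ
    blockSize B i = count (B i) (allVecs d)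

    blocksThrough2 : {b : ℕ} → (Fin b → Vect d → Bool) → Vect d → Vect d → ℕ
    blocksThrough2 {b} B x y = count (λ i → B i x ∧ B i y) (allFin b)

    blocksThrough : {b : ℕ} → (Fin b → Vect d → Bool) → Vect d → ℕ
    blocksThrough {b} B x = count (λ i → B i x) (allFin b)

    Is2Design : (b k lam : ℕ) → (Fin b → Vect d → Bool) → Set
    Is2Design b k lam B =
      DistinctBlocks b B
      × (∀ i → blockSize B i ≡ k)
      × (∀ x y → ¬ (x ≡ y) → blocksThrough2 B x y ≡ lam)

    ReplicationNumber : (b r : ℕ) → (Fin b → Vect d → Bool) → Set
    ReplicationNumber b r B = ∀ x → blocksThrough B x ≡ r

    -- G₀ ≤ GL_d(p), given by the (finite) list of its elements

    IsLinear : (Vect d → Vect d) → Set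
    IsLinear g = (∀ x y → g (vadd d x y) ≡ vadd d (g x) (g y))
               × (∀ c x → g (smul d c x) ≡ smul d c (g x))

    IsLinearGroup : List (Vect d → Vect d) → Set
    IsLinearGroup gs =
      (∀ g → g ∈ gs → IsLinear g × Bijective _≡_ _≡_ g)
      × Any (λ g → ∀ x → g x ≡ x) gs
      × (∀ g h → g ∈ gs → h ∈ gs → Any (λ k → ∀ x → k x ≡ g (h x)) gs)

    Irreducible : List (Vect d → Vect d) → Set
    Irreducible gs = ∀ (W : Vect d → Bool)
      → W (zeroV d) ≡ true
      → (∀ x y → W x ≡ true → W y ≡ true → W (vadd d x y) ≡ true)
      → (∀ c x → W x ≡ true → W (smul d c x) ≡ true)
      → (∀ g x → g ∈ gs → W x ≡ true → W (g x) ≡ true)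
      → (∀ x → W x ≡ true → x ≡ zeroV d) ⊎ (∀ x → W x ≡ true)

    -- G = T:G₀ = { x ↦ g x + t | g ∈ G₀, t ∈ V }

    PreservesDesign : {b : ℕ} → (Fin b → Vect d → Bool) → List (Vect d → Vect d) → Set
    PreservesDesign {b} B gs = ∀ g t i → g ∈ gs →
      Σ (Fin b) λ j → ∀ x → B j (aff d g t x) ≡ B i x

    FlagTransitive : {b : ℕ} → (Fin b → Vect d → Bool) → List (Vect d → Vect d) → Set
    FlagTransitive {b} B gs = ∀ x i y j → B i x ≡ true → B j y ≡ true →
      Σ (Vect d → Vect d) λ g → g ∈ gs × ∃ λ t →
        (aff d g t x ≡ y) × (∀ z → B j (aff d g t z) ≡ B i z)

    PointPrimitive : List (Vect d → Vect d) → Set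
    PointPrimitive gs = ∀ (R : Vect d → Vect d → Bool)
      → (∀ x → R x x ≡ true)
      → (∀ x y → R x y ≡ true → R y x ≡ true)
      → (∀ x y z → R x y ≡ true → R y z ≡ true → R x z ≡ true)
      → (∀ g t x y → g ∈ gs → R x y ≡ true → R (aff d g t x) (aff d g t y) ≡ true)
      → (∀ x y → R x y ≡ true → x ≡ y) ⊎ (∀ x y → R x y ≡ true)

    orbitLength : List (Vect d → Vect d) → Vect d → ℕ
    orbitLength gs x = count (λ y → any (λ g → ⌊ _≟V_ d (g x) y ⌋) gs) (allVecs d)

    -- gcd(c₁,…,c_m, p^d − 1), the cᵢ the G₀-orbit lengths on V*
    -- (each orbit length is listed once per vector in it; this does not change the gcd)
    orbitGcd : List (Vect d → Vect d) → ℕ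
    orbitGcd gs = gcdList (p ^ d ∸ 1) (L.map (orbitLength gs) nonzeroVecs)

{-# OPTIONS --safe #-}
-- Counting incidences gives r(k − 1) = λ(v − 1) and bk = vr.  Fix a block B₀: the sizes
-- xⱼ = |B₀ ∩ Bⱼ| over the other blocks satisfy Σ xⱼ = k(r − 1) and Σ xⱼ² = k(r − 1) + k(k − 1)(λ − 1),
-- and Cauchy–Schwarz on these forces k ≤ r (Fisher's inequality).  With λ = 2 and r > 2 this gives
-- 2v = r(k − 1) + 2 ≤ r(r − 1) + 2 < r².
-- For a G₀-orbit O ⊆ V∖{0}, counting pairs (y, B) with 0 ∈ B and y ∈ O ∩ B gives
-- λ|O| = Σ_{B ∋ 0} |O ∩ B|.  An element of T:G₀ fixing 0 lies in G₀, so flag-transitivity makes G₀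
-- transitive on the blocks through 0 and all |O ∩ B| agree: r divides 2|O|, so r/2 divides |O|, and
-- r/2 divides v − 1 = (r/2)(k − 1).
module Submission where

open import Data.Bool using (Bool; true; false; not; _∧_)
open import Data.Bool.ListAction using (any)
open import Data.Bool.Properties using (T-≡; ¬-not)
open import Data.Fin as F using (Fin; zero; suc; toℕ)
open import Data.Fin.Properties using (fromℕ<-cong; fromℕ<-toℕ; toℕ<n)
open import Data.List as L using (List; []; _∷_; _++_; concatMap; allFin; length; tabulate)
open import Data.List.Membership.Propositional using (_∈_; find; lose)
open import Data.List.Properties using (map-tabulate; length-map; length-tabulate)
open import Data.List.Relation.Unary.All as All using (All; []; _∷_)
open import Data.List.Relation.Unary.All.Properties using (map⁺; all-filter)
open import Data.List.Relation.Unary.Any.Properties using (any⁺; any⁻)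
open import Data.Nat
open import Data.Nat.DivMod using (_mod_; m<n⇒m%n≡m; m*n/n≡m)
open import Data.Nat.Divisibility using (_∣_; divides; *-cancelˡ-∣)
open import Data.Nat.GCD using (gcd-greatest)
open import Data.Nat.Primality using (Prime)
open import Data.Nat.Properties
open import Algebra.Properties.CommutativeSemigroup +-commutativeSemigroup using (interchange)
open import Data.Nat.Tactic.RingSolver using (solve-∀)
open import Data.Product using (∃; _×_; _,_; proj₁; proj₂)
open import Data.Sum using (inj₁; inj₂)
open import Data.Vec using ([]; _∷_)
open import Function using (_∘_)
open import Function.Bundles using (Equivalence)
open import Function.Definitions using (Bijective)
open import Relation.Binary.Definitions using (DecidableEquality)
open import Relation.Binary.PropositionalEquality
open import Relation.Nullary using (yes; no; contradiction)
open import Relation.Nullary.Decidable using (Dec; does; ⌊_⌋; dec-true; dec-false; toWitness; fromWitness; toWitnessFalse)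

open import Defs

private variable
  A C : Set

𝟙 : Bool → ℕ
𝟙 true  = 1
𝟙 false = 0

𝟙-∧ : ∀ a c → 𝟙 (a ∧ c) ≡ 𝟙 a * 𝟙 c
𝟙-∧ true  c = sym (+-identityʳ (𝟙 c))
𝟙-∧ false c = refl

𝟙-idem : ∀ a → 𝟙 a * 𝟙 a ≡ 𝟙 a
𝟙-idem true  = refl
𝟙-idem false = refl

𝟙-not : ∀ a → 𝟙 (not a) + 𝟙 a ≡ 1
𝟙-not true  = refl
𝟙-not false = refl

𝟙-mono : ∀ {a c} → (a ≡ true → c ≡ true) → 𝟙 a ≤ 𝟙 c
𝟙-mono {false} _   = z≤n
𝟙-mono {true}  a⇒c = ≤-reflexive (cong 𝟙 (sym (a⇒c refl)))

∑ : List A → (A → ℕ) → ℕ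
∑ []       f = 0
∑ (x ∷ xs) f = f x + ∑ xs f

infix 5 ∑
syntax ∑ xs (λ x → e) = ∑[ x ← xs ] e

count≡∑ : (P : A → Bool) (xs : List A) → count P xs ≡ ∑[ x ← xs ] 𝟙 (P x)
count≡∑ P []       = refl
count≡∑ P (x ∷ xs) with P x
... | true  = cong suc (count≡∑ P xs)
... | false = count≡∑ P xs

∑-cong : (xs : List A) {f g : A → ℕ} → (∀ x → f x ≡ g x) → ∑ xs f ≡ ∑ xs g
∑-cong []       f≗g = refl
∑-cong (x ∷ xs) f≗g = cong₂ _+_ (f≗g x) (∑-cong xs f≗g)

∑-mono-≤ : (xs : List A) {f g : A → ℕ} → (∀ x → f x ≤ g x) → ∑ xs f ≤ ∑ xs g
∑-mono-≤ []       f≤g = z≤n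
∑-mono-≤ (x ∷ xs) f≤g = +-mono-≤ (f≤g x) (∑-mono-≤ xs f≤g)

∑-distrib-+ : (xs : List A) (f g : A → ℕ) → ∑[ x ← xs ] f x + g x ≡ ∑ xs f + ∑ xs g
∑-distrib-+ []       f g = refl
∑-distrib-+ (x ∷ xs) f g =
  trans (cong (f x + g x +_) (∑-distrib-+ xs f g)) (interchange (f x) (g x) (∑ xs f) (∑ xs g))

∑-*ˡ : (xs : List A) (c : ℕ) (f : A → ℕ) → ∑[ x ← xs ] c * f x ≡ c * ∑ xs f
∑-*ˡ []       c f = sym (*-zeroʳ c)
∑-*ˡ (x ∷ xs) c f = trans (cong (c * f x +_) (∑-*ˡ xs c f)) (sym (*-distribˡ-+ c (f x) (∑ xs f)))

∑-*ʳ : (xs : List A) (c : ℕ) (f : A → ℕ) → ∑[ x ← xs ] f x * c ≡ ∑ xs f * c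
∑-*ʳ xs c f = begin
  ∑[ x ← xs ] f x * c  ≡⟨ ∑-cong xs (λ x → *-comm (f x) c) ⟩
  ∑[ x ← xs ] c * f x  ≡⟨ ∑-*ˡ xs c f ⟩
  c * ∑ xs f           ≡⟨ *-comm c (∑ xs f) ⟩
  ∑ xs f * c           ∎
  where open ≡-Reasoning

∑-const : (xs : List A) (c : ℕ) → ∑[ _ ← xs ] c ≡ length xs * c
∑-const []       c = refl
∑-const (x ∷ xs) c = cong (c +_) (∑-const xs c)

∑-1 : (xs : List A) → ∑[ _ ← xs ] 1 ≡ length xs
∑-1 xs = trans (∑-const xs 1) (*-identityʳ (length xs))

∑-++ : (xs ys : List A) (f : A → ℕ) → ∑ (xs ++ ys) f ≡ ∑ xs f + ∑ ys f
∑-++ []       ys f = refl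
∑-++ (x ∷ xs) ys f = trans (cong (f x +_) (∑-++ xs ys f)) (sym (+-assoc (f x) _ _))

∑-map : (g : C → A) (xs : List C) (f : A → ℕ) → ∑ (L.map g xs) f ≡ ∑[ x ← xs ] f (g x)
∑-map g []       f = refl
∑-map g (x ∷ xs) f = cong (f (g x) +_) (∑-map g xs f)

∑-concatMap : (g : C → List A) (xs : List C) (f : A → ℕ) →
              ∑ (concatMap g xs) f ≡ ∑[ x ← xs ] ∑ (g x) f
∑-concatMap g []       f = refl
∑-concatMap g (x ∷ xs) f =
  trans (∑-++ (g x) (concatMap g xs) f) (cong (∑ (g x) f +_) (∑-concatMap g xs f))

∑-zero : (xs : List A) → ∑[ _ ← xs ] 0 ≡ 0
∑-zero xs = trans (∑-const xs 0) (*-zeroʳ (length xs))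

∑-comm : (xs : List A) (ys : List C) (f : A → C → ℕ) →
         ∑[ x ← xs ] ∑[ y ← ys ] f x y ≡ ∑[ y ← ys ] ∑[ x ← xs ] f x y
∑-comm []       ys f = sym (∑-zero ys)
∑-comm (x ∷ xs) ys f =
  trans (cong (∑ ys (f x) +_) (∑-comm xs ys f)) (sym (∑-distrib-+ ys (f x) _))

∑-*-∑ : (xs : List A) (ys : List C) (f : A → ℕ) (g : C → ℕ) →
        ∑ xs f * ∑ ys g ≡ ∑[ x ← xs ] ∑[ y ← ys ] f x * g y
∑-*-∑ xs ys f g = begin
  ∑ xs f * ∑ ys g                   ≡⟨ ∑-*ʳ xs (∑ ys g) f ⟨
  ∑[ x ← xs ] f x * ∑ ys g          ≡⟨ ∑-cong xs (λ x → ∑-*ˡ ys (f x) g) ⟨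
  ∑[ x ← xs ] ∑[ y ← ys ] f x * g y ∎
  where open ≡-Reasoning

2*m*n≤m*m+n*n : ∀ m n → 2 * (m * n) ≤ m * m + n * n
2*m*n≤m*m+n*n m n with ≤-total m n
... | inj₁ m≤n with m≤n⇒∃[o]m+o≡n m≤n
...   | o , refl = ≤-trans (m≤m+n _ (o * o)) (≤-reflexive (square-gap m o))
  where
  square-gap : ∀ m o → 2 * (m * (m + o)) + o * o ≡ m * m + (m + o) * (m + o)
  square-gap = solve-∀
2*m*n≤m*m+n*n m n | inj₂ n≤m with m≤n⇒∃[o]m+o≡n n≤m
...   | o , refl = ≤-trans (m≤m+n _ (o * o)) (≤-reflexive (square-gap n o))
  where
  square-gap : ∀ n o → 2 * ((n + o) * n) + o * o ≡ (n + o) * (n + o) + n * n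
  square-gap = solve-∀

-- Expand both sides as double sums; termwise 2 xᵢ xⱼ ≤ xᵢ² + xⱼ².
cauchy-schwarz : {A : Set} (xs : List A) (w x : A → ℕ) →
                 (∑[ i ← xs ] w i * x i) * (∑[ i ← xs ] w i * x i)
                   ≤ ∑ xs w * (∑[ i ← xs ] w i * (x i * x i))
cauchy-schwarz {A} xs w x = *-cancelˡ-≤ 2 (begin
  2 * (S * S)
    ≡⟨ cong (2 *_) (∑-*-∑ xs xs wx wx) ⟩
  2 * (∑[ i ← xs ] ∑[ j ← xs ] wx i * wx j)
    ≡⟨ ∑-*ˡ xs 2 _ ⟨
  ∑[ i ← xs ] 2 * (∑[ j ← xs ] wx i * wx j)
    ≡⟨ ∑-cong xs (λ i → ∑-*ˡ xs 2 _) ⟨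
  ∑[ i ← xs ] ∑[ j ← xs ] 2 * (wx i * wx j)
    ≤⟨ ∑-mono-≤ xs (λ i → ∑-mono-≤ xs (λ j → termwise i j)) ⟩
  ∑[ i ← xs ] ∑[ j ← xs ] (w i * wxx j + wxx i * w j)
    ≡⟨ ∑-cong xs (λ i → ∑-distrib-+ xs _ _) ⟩
  ∑[ i ← xs ] ((∑[ j ← xs ] w i * wxx j) + (∑[ j ← xs ] wxx i * w j))
    ≡⟨ ∑-distrib-+ xs _ _ ⟩
  (∑[ i ← xs ] ∑[ j ← xs ] w i * wxx j) + (∑[ i ← xs ] ∑[ j ← xs ] wxx i * w j)
    ≡⟨ cong₂ _+_ (∑-*-∑ xs xs w wxx) (∑-*-∑ xs xs wxx w) ⟨
  W * Q + Q * W
    ≡⟨ cong (W * Q +_) (*-comm Q W) ⟩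
  W * Q + W * Q
    ≡⟨ cong (W * Q +_) (+-identityʳ (W * Q)) ⟨
  2 * (W * Q) ∎)
  where
  open ≤-Reasoning
  wx wxx : A → ℕ
  wx i = w i * x i
  wxx i = w i * (x i * x i)
  S W Q : ℕ
  S = ∑ xs wx
  W = ∑ xs w
  Q = ∑ xs wxx
  termwise : ∀ i j → 2 * (wx i * wx j) ≤ w i * wxx j + wxx i * w j
  termwise i j = begin
    2 * (wx i * wx j)
      ≡⟨ regroupˡ (w i) (w j) (x i) (x j) ⟩
    w i * w j * (2 * (x i * x j))
      ≤⟨ *-monoʳ-≤ (w i * w j) (2*m*n≤m*m+n*n (x i) (x j)) ⟩
    w i * w j * (x i * x i + x j * x j)
      ≡⟨ regroupʳ (w i) (w j) (x i) (x j) ⟩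
    w i * wxx j + wxx i * w j ∎
    where
    regroupˡ : ∀ a c y z → 2 * ((a * y) * (c * z)) ≡ a * c * (2 * (y * z))
    regroupˡ = solve-∀
    regroupʳ : ∀ a c y z → a * c * (y * y + z * z) ≡ a * (c * (z * z)) + a * (y * y) * c
    regroupʳ = solve-∀

does-⇔ : {P Q : Set} (p? : Dec P) (q? : Dec Q) → (P → Q) → (Q → P) → does p? ≡ does q?
does-⇔ (yes p) q? p→q _   = sym (dec-true q? (p→q p))
does-⇔ (no ¬p) q? _   q→p = sym (dec-false q? (¬p ∘ q→p))

-- Stated with `does`, which unlike ⌊_⌋ commutes definitionally with map′ and _×-dec_
-- (the combinators behind the decidable equalities of Fin and Vec).
Enumerates : DecidableEquality A → List A → Set
Enumerates _≟_ E = ∀ x → ∑[ y ← E ] 𝟙 (does (y ≟ x)) ≡ 1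

module Enumeration {A : Set} (_≟_ : DecidableEquality A) (E : List A) (enum : Enumerates _≟_ E) where

  δ : A → A → ℕ
  δ y x = 𝟙 (does (y ≟ x))

  δ-* : ∀ y x (f : A → ℕ) → δ y x * f y ≡ δ y x * f x
  δ-* y x f with y ≟ x
  ... | yes refl = refl
  ... | no  _    = refl

  ∑-δ : ∀ x (f : A → ℕ) → ∑[ y ← E ] δ y x * f y ≡ f x
  ∑-δ x f = begin
    ∑[ y ← E ] δ y x * f y  ≡⟨ ∑-cong E (λ y → δ-* y x f) ⟩
    ∑[ y ← E ] δ y x * f x  ≡⟨ ∑-*ʳ E (f x) (λ y → δ y x) ⟩
    (∑[ y ← E ] δ y x) * f x ≡⟨ cong (_* f x) (enum x) ⟩
    1 * f x                 ≡⟨ *-identityˡ (f x) ⟩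
    f x                     ∎
    where open ≡-Reasoning

  ∑-∘-bijection : {g : A → A} → Bijective _≡_ _≡_ g → (f : A → ℕ) → ∑[ z ← E ] f (g z) ≡ ∑ E f
  ∑-∘-bijection {g} (g-inj , g-surj) f = begin
    ∑[ z ← E ] f (g z)
      ≡⟨ ∑-cong E (λ z → ∑-δ (g z) f) ⟨
    ∑[ z ← E ] ∑[ y ← E ] δ y (g z) * f y
      ≡⟨ ∑-comm E E _ ⟩
    ∑[ y ← E ] ∑[ z ← E ] δ y (g z) * f y
      ≡⟨ ∑-cong E (λ y → ∑-*ʳ E (f y) (λ z → δ y (g z))) ⟩
    ∑[ y ← E ] (∑[ z ← E ] δ y (g z)) * f y
      ≡⟨ ∑-cong E (λ y → cong (_* f y) (preimage-unique y)) ⟩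
    ∑[ y ← E ] 1 * f y
      ≡⟨ ∑-cong E (λ y → *-identityˡ (f y)) ⟩
    ∑ E f ∎
    where
    open ≡-Reasoning
    preimage-unique : ∀ y → ∑[ z ← E ] δ y (g z) ≡ 1
    preimage-unique y = trans (∑-cong E (λ z → cong 𝟙 (does-⇔ (y ≟ g z) (z ≟ g⁻¹y) to from))) (enum g⁻¹y)
      where
      g⁻¹y : A
      g⁻¹y = proj₁ (g-surj y)
      from : ∀ {z} → z ≡ g⁻¹y → y ≡ g z
      from z≡g⁻¹y = sym (proj₂ (g-surj y) z≡g⁻¹y)
      to : ∀ {z} → y ≡ g z → z ≡ g⁻¹y
      to y≡gz = g-inj (trans (sym y≡gz) (sym (proj₂ (g-surj y) refl)))

∑-𝟙-witness : (P : A → Bool) (xs : List A) → 0 < ∑[ x ← xs ] 𝟙 (P x) → ∃ λ x → P x ≡ true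
∑-𝟙-witness P (x ∷ xs) 0<∑ with P x in Px
... | true  = x , Px
... | false = ∑-𝟙-witness P xs 0<∑

∑-allFin-suc : ∀ n (f : Fin (suc n) → ℕ) → ∑ (allFin (suc n)) f ≡ f zero + (∑[ i ← allFin n ] f (suc i))
∑-allFin-suc n f = cong (f zero +_) (begin
  ∑ (tabulate suc) f          ≡⟨ cong (λ xs → ∑ xs f) (map-tabulate (λ i → i) suc) ⟨
  ∑ (L.map suc (allFin n)) f  ≡⟨ ∑-map suc (allFin n) f ⟩
  ∑[ i ← allFin n ] f (suc i) ∎)
  where open ≡-Reasoning

allFin-enumerates : ∀ n → Enumerates F._≟_ (allFin n)
allFin-enumerates (suc n) zero    =
  trans (∑-allFin-suc n (λ j → 𝟙 (does (j F.≟ zero)))) (cong suc (∑-zero (allFin n)))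
allFin-enumerates (suc n) (suc i) =
  trans (∑-allFin-suc n (λ j → 𝟙 (does (j F.≟ suc i)))) (allFin-enumerates n i)

-- Writing λ = 1 + l < r = λ + 1 + a < k = r + 1 + e, the hypotheses force the polynomial
-- identity λk(S² − WQ) = k(k − r)(r − λ)²(k − 1), whose right side is positive.
fisher-excess : ∀ l a e {v W S Q} → let lam = suc l; r = suc lam + a; k = suc r + e in
  lam * v + r ≡ r * k + lam → (W + 1) * k ≡ v * r →
  S + k ≡ k * r → Q + k * k + lam * k ≡ lam * k * k + k * r → W * Q < S * S
fisher-excess l a e {v} {W} {S} {Q} rep flags S+k≡kr Q≡ =
  *-cancelˡ-< (lam * k) (W * Q) (S * S) (+-cancelʳ-< (lam * k * Q) _ _ (begin-strict
    lam * k * (W * Q) + lam * k * Q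
      ≡⟨ solve-lhs lam k W Q ⟩
    lam * ((W + 1) * k) * Q
      ≡⟨ cong (λ t → lam * t * Q) flags ⟩
    lam * (v * r) * Q
      ≡⟨ cong (_* Q) (*-assoc lam v r) ⟨
    lam * v * r * Q
      ≡⟨ cong (λ t → t * r * Q) lam*v ⟩
    (r * (r + e) + lam) * r * Q
      <⟨ m<m+n _ excess>0 ⟩
    (r * (r + e) + lam) * r * Q + excess
      ≡⟨ cong (λ t → (r * (r + e) + lam) * r * t + excess) Q≡Qc ⟩
    (r * (r + e) + lam) * r * Qc + excess
      ≡⟨ variance-identity l a e ⟩
    lam * k * (Sc * Sc) + lam * k * Qc
      ≡⟨ cong₂ (λ s t → lam * k * (s * s) + lam * k * t) S≡Sc Q≡Qc ⟨
    lam * k * (S * S) + lam * k * Q ∎))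
  where
  open ≤-Reasoning
  lam r k Sc Qc excess : ℕ
  lam = suc l
  r = suc lam + a
  k = suc r + e
  Sc = k * (suc l + a)
  Qc = k * ((suc l + a) + (r + e) * l)
  excess = k * suc e * (suc a * suc a) * (r + e)
  excess>0 : 0 < excess
  excess>0 = s≤s z≤n
  solve-lhs : ∀ lam k W Q → lam * k * (W * Q) + lam * k * Q ≡ lam * ((W + 1) * k) * Q
  solve-lhs = solve-∀
  lam*v : lam * v ≡ r * (r + e) + lam
  lam*v = +-cancelʳ-≡ r _ _ (trans rep (kr l a e))
    where
    kr : ∀ l a e → let lam = suc l; r = suc lam + a in r * (suc r + e) + lam ≡ r * (r + e) + lam + r
    kr = solve-∀
  S≡Sc : S ≡ Sc
  S≡Sc = +-cancelʳ-≡ k _ _ (trans S+k≡kr (trans (*-suc k (suc l + a)) (+-comm k Sc)))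
  Q≡Qc : Q ≡ Qc
  Q≡Qc = +-cancelʳ-≡ (k * k) _ _ (+-cancelʳ-≡ (lam * k) _ _ (trans Q≡ (kQ l a e)))
    where
    kQ : ∀ l a e → let lam = suc l; r = suc lam + a; k = suc r + e in
         lam * k * k + k * r ≡ k * ((suc l + a) + (r + e) * l) + k * k + lam * k
    kQ = solve-∀
  variance-identity : ∀ l a e → let lam = suc l; r = suc lam + a; k = suc r + e in
    (r * (r + e) + lam) * r * (k * ((suc l + a) + (r + e) * l)) + k * suc e * (suc a * suc a) * (r + e)
      ≡ lam * k * ((k * (suc l + a)) * (k * (suc l + a))) + lam * k * (k * ((suc l + a) + (r + e) * l))
  variance-identity = solve-∀

fisher-arithmetic : ∀ {lam r k v b W S Q} → 0 < lam → lam < r →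
  r * k + lam ≡ lam * v + r → b * k ≡ v * r → W + 1 ≡ b →
  S + k ≡ k * r → Q + k * k + lam * k ≡ lam * k * k + k * r → S * S ≤ W * Q → k ≤ r
fisher-arithmetic {r = r} {k} {W = W} 0<lam lam<r rep flags refl S+k≡kr Q≡ cs with k ≤? r
... | yes k≤r = k≤r
... | no  k≰r with m≤n⇒∃[o]m+o≡n 0<lam | m≤n⇒∃[o]m+o≡n lam<r | m≤n⇒∃[o]m+o≡n (≰⇒> k≰r)
...   | l , refl | a , refl | e , refl =
  contradiction cs (<⇒≱ (fisher-excess l a e {W = W} (sym rep) flags S+k≡kr Q≡))

m*k+n≤n*k+m : ∀ {m n k} → m ≤ n → 0 < k → m * k + n ≤ n * k + m
m*k+n≤n*k+m {m} {k = suc k} m≤n _ with m≤n⇒∃[o]m+o≡n m≤n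
... | o , refl = ≤-trans (m≤m+n (m * suc k + (m + o)) (o * k)) (≤-reflexive (exchange m o k))
  where
  exchange : ∀ m o k → m * suc k + (m + o) + o * k ≡ (m + o) * suc k + m
  exchange = solve-∀

lam<r : ∀ {lam r k v} → 0 < lam → 0 < k → k < v → r * k + lam ≡ lam * v + r → lam < r
lam<r {lam} {r} {k} {v} 0<lam 0<k k<v rep = ≰⇒> r≰lam
  where
  r≰lam : r ≰ lam
  r≰lam r≤lam = <-irrefl rep (begin-strict
    r * k + lam   ≤⟨ m*k+n≤n*k+m r≤lam 0<k ⟩
    lam * k + r   <⟨ +-monoˡ-< r (*-monoʳ-< lam {{>-nonZero 0<lam}} k<v) ⟩
    lam * v + r   ∎)
    where open ≤-Reasoning

lam*v<r*r : ∀ {lam r k v} → r * k + lam ≡ lam * v + r → k ≤ r → lam < r → lam * v < r * r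
lam*v<r*r {lam} {r} {k} {v} rep k≤r lam<r = +-cancelʳ-< r (lam * v) (r * r) (begin-strict
  lam * v + r   ≡⟨ rep ⟨
  r * k + lam   ≤⟨ +-monoˡ-≤ lam (*-monoʳ-≤ r k≤r) ⟩
  r * r + lam   <⟨ +-monoʳ-< (r * r) lam<r ⟩
  r * r + r     ∎)
  where open ≤-Reasoning

h∣v∸1 : ∀ {h lam k v} .{{_ : NonZero lam}} → 0 < k → h * lam * k + lam ≡ lam * v + h * lam → h ∣ v ∸ 1
h∣v∸1 {h} {lam} {suc k} {v} _ rep = divides k (begin
  v ∸ 1           ≡⟨ cong (_∸ 1) v≡hk+1 ⟩
  h * k + 1 ∸ 1   ≡⟨ m+n∸n≡m (h * k) 1 ⟩
  h * k           ≡⟨ *-comm h k ⟩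
  k * h           ∎)
  where
  open ≡-Reasoning
  v≡hk+1 : v ≡ h * k + 1
  v≡hk+1 = +-cancelʳ-≡ h _ _ (*-cancelˡ-≡ _ _ lam (begin
    lam * (v + h)               ≡⟨ *-distribˡ-+ lam v h ⟩
    lam * v + lam * h           ≡⟨ cong (lam * v +_) (*-comm lam h) ⟩
    lam * v + h * lam           ≡⟨ rep ⟨
    h * lam * suc k + lam       ≡⟨ regroup h lam k ⟩
    lam * (h * k + 1 + h)       ∎))
    where
    regroup : ∀ h lam k → h * lam * suc k + lam ≡ lam * (h * k + 1 + h)
    regroup = solve-∀

module Design {P : Set} (_≟_ : DecidableEquality P) (E : List P) (E-enum : Enumerates _≟_ E)
              {b : ℕ} (B : Fin b → P → Bool) {k r lam : ℕ}
              (block-size : ∀ i → count (B i) E ≡ k)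
              (replication : ∀ x → count (λ i → B i x) (allFin b) ≡ r)
              (balance : ∀ x y → x ≢ y → count (λ i → B i x ∧ B i y) (allFin b) ≡ lam) where

  open Enumeration _≟_ E E-enum
  private
    module Blocks = Enumeration F._≟_ (allFin b) (allFin-enumerates b)
    ℬ : List (Fin b)
    ℬ = allFin b

  v : ℕ
  v = length E

  χ : P → Fin b → ℕ
  χ y i = 𝟙 (B i y)

  concurrence : P → P → ℕ
  concurrence x y = ∑[ i ← ℬ ] χ x i * χ y i

  meet : (P → Bool) → Fin b → ℕ
  meet S i = ∑[ y ← E ] 𝟙 (S y) * χ y i

  ∑-χ-point : ∀ x → ∑[ i ← ℬ ] χ x i ≡ r
  ∑-χ-point x = trans (sym (count≡∑ (λ i → B i x) ℬ)) (replication x)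

  ∑-χ-block : ∀ i → ∑[ y ← E ] χ y i ≡ k
  ∑-χ-block i = trans (sym (count≡∑ (B i) E)) (block-size i)

  concurrence-δ : ∀ x y → concurrence x y + lam * δ y x ≡ lam + δ y x * r
  concurrence-δ x y with y ≟ x
  ... | yes refl = begin
    concurrence x x + lam * 1
      ≡⟨ cong₂ _+_ (trans (∑-cong ℬ (λ i → 𝟙-idem (B i x))) (∑-χ-point x)) (*-identityʳ lam) ⟩
    r + lam
      ≡⟨ +-comm r lam ⟩
    lam + r
      ≡⟨ cong (lam +_) (+-identityʳ r) ⟨
    lam + 1 * r ∎
    where open ≡-Reasoning
  ... | no y≢x = cong₂ _+_ (trans (sym count≡concurrence) (balance x y (y≢x ∘ sym))) (*-zeroʳ lam)
    where
    count≡concurrence : count (λ i → B i x ∧ B i y) ℬ ≡ concurrence x y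
    count≡concurrence = trans (count≡∑ _ ℬ) (∑-cong ℬ (λ i → 𝟙-∧ (B i x) (B i y)))

  size : (P → Bool) → ℕ
  size S = ∑[ y ← E ] 𝟙 (S y)

  ∑-concurrence : ∀ x (S : P → Bool) →
    (∑[ y ← E ] 𝟙 (S y) * concurrence x y) + lam * 𝟙 (S x) ≡ lam * size S + 𝟙 (S x) * r
  ∑-concurrence x S = begin
    (∑[ y ← E ] c y * concurrence x y) + lam * c x
      ≡⟨ cong (λ t → (∑[ y ← E ] c y * concurrence x y) + lam * t) (∑-δ x c) ⟨
    (∑[ y ← E ] c y * concurrence x y) + lam * (∑[ y ← E ] δ y x * c y)
      ≡⟨ cong ((∑[ y ← E ] c y * concurrence x y) +_) (∑-*ˡ E lam _) ⟨
    (∑[ y ← E ] c y * concurrence x y) + (∑[ y ← E ] lam * (δ y x * c y))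
      ≡⟨ ∑-distrib-+ E _ _ ⟨
    ∑[ y ← E ] (c y * concurrence x y + lam * (δ y x * c y))
      ≡⟨ ∑-cong E (λ y → factor-c (c y) (concurrence x y) lam (δ y x)) ⟩
    ∑[ y ← E ] c y * (concurrence x y + lam * δ y x)
      ≡⟨ ∑-cong E (λ y → cong (c y *_) (concurrence-δ x y)) ⟩
    ∑[ y ← E ] c y * (lam + δ y x * r)
      ≡⟨ ∑-cong E (λ y → expand-c (c y) lam (δ y x) r) ⟩
    ∑[ y ← E ] (lam * c y + δ y x * c y * r)
      ≡⟨ ∑-distrib-+ E _ _ ⟩
    (∑[ y ← E ] lam * c y) + (∑[ y ← E ] δ y x * c y * r)
      ≡⟨ cong₂ _+_ (∑-*ˡ E lam c) (trans (∑-*ʳ E r _) (cong (_* r) (∑-δ x c))) ⟩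
    lam * size S + c x * r ∎
    where
    open ≡-Reasoning
    c : P → ℕ
    c y = 𝟙 (S y)
    factor-c : ∀ c s l d → c * s + l * (d * c) ≡ c * (s + l * d)
    factor-c = solve-∀
    expand-c : ∀ c l d r → c * (l + d * r) ≡ l * c + d * c * r
    expand-c = solve-∀

  ∑-concurrence≡∑-meet : ∀ x (S : P → Bool) →
    ∑[ y ← E ] 𝟙 (S y) * concurrence x y ≡ ∑[ i ← ℬ ] χ x i * meet S i
  ∑-concurrence≡∑-meet x S = begin
    ∑[ y ← E ] 𝟙 (S y) * concurrence x y
      ≡⟨ ∑-cong E (λ y → ∑-*ˡ ℬ (𝟙 (S y)) _) ⟨
    ∑[ y ← E ] ∑[ i ← ℬ ] 𝟙 (S y) * (χ x i * χ y i)
      ≡⟨ ∑-comm E ℬ _ ⟩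
    ∑[ i ← ℬ ] ∑[ y ← E ] 𝟙 (S y) * (χ x i * χ y i)
      ≡⟨ ∑-cong ℬ (λ i → trans (∑-cong E (λ y → x*yz≡y*xz (𝟙 (S y)) (χ x i) (χ y i))) (∑-*ˡ E (χ x i) _)) ⟩
    ∑[ i ← ℬ ] χ x i * meet S i ∎
    where
    open ≡-Reasoning
    x*yz≡y*xz : ∀ a c d → a * (c * d) ≡ c * (a * d)
    x*yz≡y*xz = solve-∀

  replication-identity : P → r * k + lam ≡ lam * v + r
  replication-identity x = begin
    r * k + lam
      ≡⟨ cong (λ t → t * k + lam) (∑-χ-point x) ⟨
    (∑[ i ← ℬ ] χ x i) * k + lam
      ≡⟨ cong (_+ lam) (∑-*ʳ ℬ k (χ x)) ⟨
    (∑[ i ← ℬ ] χ x i * k) + lam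
      ≡⟨ cong₂ _+_ (∑-cong ℬ (λ i → cong (χ x i *_) meet-everything)) (*-identityʳ lam) ⟨
    (∑[ i ← ℬ ] χ x i * meet everything i) + lam * 1
      ≡⟨ cong (_+ lam * 1) (∑-concurrence≡∑-meet x everything) ⟨
    (∑[ y ← E ] 1 * concurrence x y) + lam * 1
      ≡⟨ ∑-concurrence x everything ⟩
    lam * size everything + 1 * r
      ≡⟨ cong₂ _+_ (cong (lam *_) (∑-1 E)) (*-identityˡ r) ⟩
    lam * v + r ∎
    where
    open ≡-Reasoning
    everything : P → Bool
    everything _ = true
    meet-everything : ∀ {i} → meet everything i ≡ k
    meet-everything {i} = trans (∑-cong E (λ y → *-identityˡ (χ y i))) (∑-χ-block i)

  b*k≡v*r : b * k ≡ v * r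
  b*k≡v*r = begin
    b * k                               ≡⟨ cong (_* k) (length-tabulate {n = b} (λ i → i)) ⟨
    length ℬ * k                        ≡⟨ ∑-const ℬ k ⟨
    ∑[ _ ← ℬ ] k                        ≡⟨ ∑-cong ℬ ∑-χ-block ⟨
    ∑[ i ← ℬ ] ∑[ y ← E ] χ y i         ≡⟨ ∑-comm E ℬ χ ⟨
    ∑[ y ← E ] ∑[ i ← ℬ ] χ y i         ≡⟨ ∑-cong E ∑-χ-point ⟩
    ∑[ _ ← E ] r                        ≡⟨ ∑-const E r ⟩
    v * r                               ∎
    where open ≡-Reasoning

  block-through : ∀ x → 0 < r → ∃ λ i → B i x ≡ true
  block-through x 0<r = ∑-𝟙-witness (λ i → B i x) ℬ (subst (0 <_) (sym (∑-χ-point x)) 0<r)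

  ∑-meet : ∀ S → ∑[ j ← ℬ ] meet S j ≡ size S * r
  ∑-meet S = begin
    ∑[ j ← ℬ ] ∑[ y ← E ] 𝟙 (S y) * χ y j
      ≡⟨ ∑-comm E ℬ _ ⟨
    ∑[ y ← E ] ∑[ j ← ℬ ] 𝟙 (S y) * χ y j
      ≡⟨ ∑-cong E (λ y → trans (∑-*ˡ ℬ (𝟙 (S y)) (χ y)) (cong (𝟙 (S y) *_) (∑-χ-point y))) ⟩
    ∑[ y ← E ] 𝟙 (S y) * r
      ≡⟨ ∑-*ʳ E r _ ⟩
    size S * r ∎
    where open ≡-Reasoning

  ∑-meet²≡∑∑-concurrence : ∀ S →
    ∑[ j ← ℬ ] meet S j * meet S j ≡ ∑[ y ← E ] 𝟙 (S y) * (∑[ z ← E ] 𝟙 (S z) * concurrence y z)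
  ∑-meet²≡∑∑-concurrence S = begin
    ∑[ j ← ℬ ] meet S j * meet S j
      ≡⟨ ∑-cong ℬ (λ j → ∑-*ˡ E (meet S j) _) ⟨
    ∑[ j ← ℬ ] ∑[ y ← E ] meet S j * (𝟙 (S y) * χ y j)
      ≡⟨ ∑-comm E ℬ _ ⟨
    ∑[ y ← E ] ∑[ j ← ℬ ] meet S j * (𝟙 (S y) * χ y j)
      ≡⟨ ∑-cong E (λ y → trans (∑-cong ℬ (λ j → regroup (meet S j) (𝟙 (S y)) (χ y j))) (∑-*ˡ ℬ (𝟙 (S y)) _)) ⟩
    ∑[ y ← E ] 𝟙 (S y) * (∑[ j ← ℬ ] χ y j * meet S j)
      ≡⟨ ∑-cong E (λ y → cong (𝟙 (S y) *_) (∑-concurrence≡∑-meet y S)) ⟨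
    ∑[ y ← E ] 𝟙 (S y) * (∑[ z ← E ] 𝟙 (S z) * concurrence y z) ∎
    where
    open ≡-Reasoning
    regroup : ∀ m c x → m * (c * x) ≡ c * (x * m)
    regroup = solve-∀

  ∑-meet² : ∀ S → (∑[ j ← ℬ ] meet S j * meet S j) + lam * size S ≡ lam * size S * size S + size S * r
  ∑-meet² S = begin
    (∑[ j ← ℬ ] meet S j * meet S j) + lam * size S
      ≡⟨ cong₂ _+_ (∑-meet²≡∑∑-concurrence S) (sym (∑-*ˡ E lam c)) ⟩
    (∑[ y ← E ] c y * a y) + (∑[ y ← E ] lam * c y)
      ≡⟨ ∑-distrib-+ E _ _ ⟨
    ∑[ y ← E ] (c y * a y + lam * c y)
      ≡⟨ ∑-cong E (λ y → absorbˡ (S y) (a y) lam) ⟩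
    ∑[ y ← E ] c y * (a y + lam * c y)
      ≡⟨ ∑-cong E (λ y → cong (c y *_) (∑-concurrence y S)) ⟩
    ∑[ y ← E ] c y * (lam * size S + c y * r)
      ≡⟨ ∑-cong E (λ y → absorbʳ (S y) (lam * size S) r) ⟩
    ∑[ y ← E ] (lam * size S * c y + c y * r)
      ≡⟨ ∑-distrib-+ E _ _ ⟩
    (∑[ y ← E ] lam * size S * c y) + (∑[ y ← E ] c y * r)
      ≡⟨ cong₂ _+_ (∑-*ˡ E (lam * size S) c) (∑-*ʳ E r c) ⟩
    lam * size S * size S + size S * r ∎
    where
    open ≡-Reasoning
    c a : P → ℕ
    c y = 𝟙 (S y)
    a y = ∑[ z ← E ] c z * concurrence y z
    absorbˡ : ∀ s a l → 𝟙 s * a + l * 𝟙 s ≡ 𝟙 s * (a + l * 𝟙 s)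
    absorbˡ s a l = begin
      𝟙 s * a + l * 𝟙 s             ≡⟨ cong (λ t → 𝟙 s * a + l * t) (𝟙-idem s) ⟨
      𝟙 s * a + l * (𝟙 s * 𝟙 s)     ≡⟨ ring (𝟙 s) a l ⟩
      𝟙 s * (a + l * 𝟙 s)           ∎
      where
      ring : ∀ c a l → c * a + l * (c * c) ≡ c * (a + l * c)
      ring = solve-∀
    absorbʳ : ∀ s n r → 𝟙 s * (n + 𝟙 s * r) ≡ n * 𝟙 s + 𝟙 s * r
    absorbʳ s n r = begin
      𝟙 s * (n + 𝟙 s * r)           ≡⟨ ring (𝟙 s) n r ⟩
      n * 𝟙 s + 𝟙 s * 𝟙 s * r       ≡⟨ cong (λ t → n * 𝟙 s + t * r) (𝟙-idem s) ⟩
      n * 𝟙 s + 𝟙 s * r             ∎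
      where
      ring : ∀ c n r → c * (n + c * r) ≡ n * c + c * c * r
      ring = solve-∀

  module _ (i₀ : Fin b) where

    other : Fin b → ℕ
    other j = 𝟙 (not (does (j F.≟ i₀)))

    ∑-other : ∀ f → (∑[ j ← ℬ ] other j * f j) + f i₀ ≡ ∑ ℬ f
    ∑-other f = begin
      (∑[ j ← ℬ ] other j * f j) + f i₀
        ≡⟨ cong ((∑[ j ← ℬ ] other j * f j) +_) (Blocks.∑-δ i₀ f) ⟨
      (∑[ j ← ℬ ] other j * f j) + (∑[ j ← ℬ ] Blocks.δ j i₀ * f j)
        ≡⟨ ∑-distrib-+ ℬ _ _ ⟨
      ∑[ j ← ℬ ] (other j * f j + Blocks.δ j i₀ * f j)
        ≡⟨ ∑-cong ℬ (λ j → *-distribʳ-+ (f j) (other j) _) ⟨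
      ∑[ j ← ℬ ] (other j + Blocks.δ j i₀) * f j
        ≡⟨ ∑-cong ℬ (λ j → cong (_* f j) (𝟙-not (does (j F.≟ i₀)))) ⟩
      ∑[ j ← ℬ ] 1 * f j
        ≡⟨ ∑-cong ℬ (λ j → *-identityˡ (f j)) ⟩
      ∑ ℬ f ∎
      where open ≡-Reasoning

    ∑-other≡b-1 : ∑ ℬ other + 1 ≡ b
    ∑-other≡b-1 = begin
      ∑ ℬ other + 1                  ≡⟨ cong (_+ 1) (∑-cong ℬ (λ j → *-identityʳ (other j))) ⟨
      (∑[ j ← ℬ ] other j * 1) + 1   ≡⟨ ∑-other (λ _ → 1) ⟩
      ∑[ _ ← ℬ ] 1                   ≡⟨ ∑-1 ℬ ⟩
      length ℬ                       ≡⟨ length-tabulate {n = b} (λ i → i) ⟩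
      b                              ∎
      where open ≡-Reasoning

    meet-self : meet (B i₀) i₀ ≡ k
    meet-self = trans (∑-cong E (λ y → 𝟙-idem (B i₀ y))) (∑-χ-block i₀)

    ∑-other-meet : (∑[ j ← ℬ ] other j * meet (B i₀) j) + k ≡ k * r
    ∑-other-meet = begin
      (∑[ j ← ℬ ] other j * meet (B i₀) j) + k
        ≡⟨ cong ((∑[ j ← ℬ ] other j * meet (B i₀) j) +_) meet-self ⟨
      (∑[ j ← ℬ ] other j * meet (B i₀) j) + meet (B i₀) i₀
        ≡⟨ ∑-other (meet (B i₀)) ⟩
      ∑[ j ← ℬ ] meet (B i₀) j
        ≡⟨ ∑-meet (B i₀) ⟩
      size (B i₀) * r
        ≡⟨ cong (_* r) (∑-χ-block i₀) ⟩
      k * r ∎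
      where open ≡-Reasoning

    ∑-other-meet² : (∑[ j ← ℬ ] other j * (meet (B i₀) j * meet (B i₀) j)) + k * k + lam * k
                    ≡ lam * k * k + k * r
    ∑-other-meet² = begin
      (∑[ j ← ℬ ] other j * x² j) + k * k + lam * k
        ≡⟨ cong (λ t → (∑[ j ← ℬ ] other j * x² j) + t * t + lam * k) meet-self ⟨
      (∑[ j ← ℬ ] other j * x² j) + x² i₀ + lam * k
        ≡⟨ cong (_+ lam * k) (∑-other x²) ⟩
      (∑[ j ← ℬ ] x² j) + lam * k
        ≡⟨ subst (λ t → (∑[ j ← ℬ ] x² j) + lam * t ≡ lam * t * t + t * r) (∑-χ-block i₀) (∑-meet² (B i₀)) ⟩
      lam * k * k + k * r ∎
      where
      open ≡-Reasoning
      x² : Fin b → ℕ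
      x² j = meet (B i₀) j * meet (B i₀) j

  -- Cauchy–Schwarz on the sizes of the intersections of one block with all the others.
  fisher : P → 0 < lam → lam < r → k ≤ r
  fisher x 0<lam lam<r =
    fisher-arithmetic 0<lam lam<r (replication-identity x) b*k≡v*r
      (∑-other≡b-1 i₀) (∑-other-meet i₀) (∑-other-meet² i₀) (cauchy-schwarz ℬ (other i₀) (meet (B i₀)))
    where
    i₀ : Fin b
    i₀ = proj₁ (block-through x (<-trans 0<lam lam<r))

  flag-count : ∀ o (S : P → Bool) → S o ≡ false → lam * size S ≡ ∑[ i ← ℬ ] χ o i * meet S i
  flag-count o S So≡false = begin
    lam * size S
      ≡⟨ +-identityʳ (lam * size S) ⟨
    lam * size S + 0 * r
      ≡⟨ subst (λ s → pairs + lam * 𝟙 s ≡ lam * size S + 𝟙 s * r) So≡false (∑-concurrence o S) ⟨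
    pairs + lam * 0
      ≡⟨ cong (pairs +_) (*-zeroʳ lam) ⟩
    pairs + 0
      ≡⟨ +-identityʳ pairs ⟩
    pairs
      ≡⟨ ∑-concurrence≡∑-meet o S ⟩
    ∑[ i ← ℬ ] χ o i * meet S i ∎
    where
    open ≡-Reasoning
    pairs : ℕ
    pairs = ∑[ y ← E ] 𝟙 (S y) * concurrence o y

  flag-count-uniform : ∀ o (S : P → Bool) → S o ≡ false → ∀ i₀ →
    (∀ i → B i o ≡ true → meet S i ≡ meet S i₀) → lam * size S ≡ r * meet S i₀
  flag-count-uniform o S So≡false i₀ uniform = begin
    lam * size S                    ≡⟨ flag-count o S So≡false ⟩
    ∑[ i ← ℬ ] χ o i * meet S i     ≡⟨ ∑-cong ℬ through-o ⟩
    ∑[ i ← ℬ ] χ o i * meet S i₀    ≡⟨ ∑-*ʳ ℬ (meet S i₀) (χ o) ⟩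
    (∑[ i ← ℬ ] χ o i) * meet S i₀  ≡⟨ cong (_* meet S i₀) (∑-χ-point o) ⟩
    r * meet S i₀                   ∎
    where
    open ≡-Reasoning
    through-o : ∀ i → χ o i * meet S i ≡ χ o i * meet S i₀
    through-o i with B i o in Bio
    ... | true  = cong (1 *_) (uniform i Bio)
    ... | false = refl

  meet-≤ : ∀ (S : P → Bool) {g : P → P} {i j} → Bijective _≡_ _≡_ g →
           (∀ z → S z ≡ true → S (g z) ≡ true) → (∀ z → B j (g z) ≡ B i z) → meet S i ≤ meet S j
  meet-≤ S {g} {i} {j} g-bijective S-closed g-maps-i-to-j = begin
    ∑[ z ← E ] 𝟙 (S z) * χ z i
      ≡⟨ ∑-cong E (λ z → cong (λ t → 𝟙 (S z) * 𝟙 t) (g-maps-i-to-j z)) ⟨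
    ∑[ z ← E ] 𝟙 (S z) * χ (g z) j
      ≤⟨ ∑-mono-≤ E (λ z → *-monoˡ-≤ (χ (g z) j) (𝟙-mono (S-closed z))) ⟩
    ∑[ z ← E ] 𝟙 (S (g z)) * χ (g z) j
      ≡⟨ ∑-∘-bijection g-bijective (λ y → 𝟙 (S y) * χ y j) ⟩
    meet S j ∎
    where open ≤-Reasoning

-- With p = suc q, `0 mod p` reduces to `zero`, so zeroₚ *ₚ a computes to zeroₚ.
module Vectors (q : ℕ) where

  p : ℕ
  p = suc q

  allVecs-enumerates : ∀ d → Enumerates (_≟V_ p d) (allVecs p d)
  allVecs-enumerates zero    []       = refl
  allVecs-enumerates (suc d) (x ∷ xs) = begin
    ∑[ y ← allVecs p (suc d) ] δᵥ y
      ≡⟨ ∑-concatMap (λ a → L.map (a ∷_) (allVecs p d)) (allFin p) δᵥ ⟩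
    ∑[ a ← allFin p ] ∑ (L.map (a ∷_) (allVecs p d)) δᵥ
      ≡⟨ ∑-cong (allFin p) (λ a → ∑-map (a ∷_) (allVecs p d) δᵥ) ⟩
    ∑[ a ← allFin p ] ∑[ ys ← allVecs p d ] δᵥ (a ∷ ys)
      ≡⟨ ∑-cong (allFin p) (λ a → ∑-cong (allVecs p d) (λ ys → 𝟙-∧ (does (a F.≟ x)) (does (_≟V_ p d ys xs)))) ⟩
    ∑[ a ← allFin p ] ∑[ ys ← allVecs p d ] δ₀ a * δ₁ ys
      ≡⟨ ∑-cong (allFin p) (λ a → ∑-*ˡ (allVecs p d) (δ₀ a) δ₁) ⟩
    ∑[ a ← allFin p ] δ₀ a * (∑[ ys ← allVecs p d ] δ₁ ys)
      ≡⟨ ∑-cong (allFin p) (λ a → cong (δ₀ a *_) (allVecs-enumerates d xs)) ⟩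
    ∑[ a ← allFin p ] δ₀ a * 1
      ≡⟨ ∑-cong (allFin p) (λ a → *-identityʳ (δ₀ a)) ⟩
    ∑[ a ← allFin p ] δ₀ a
      ≡⟨ allFin-enumerates p x ⟩
    1 ∎
    where
    open ≡-Reasoning
    δᵥ : Vect p (suc d) → ℕ
    δᵥ y = 𝟙 (does (_≟V_ p (suc d) y (x ∷ xs)))
    δ₀ : Fin p → ℕ
    δ₀ a = 𝟙 (does (a F.≟ x))
    δ₁ : Vect p d → ℕ
    δ₁ ys = 𝟙 (does (_≟V_ p d ys xs))

  length-allVecs : ∀ d → length (allVecs p d) ≡ p ^ d
  length-allVecs zero    = refl
  length-allVecs (suc d) = begin
    length (allVecs p (suc d))
      ≡⟨ ∑-1 (allVecs p (suc d)) ⟨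
    ∑[ _ ← allVecs p (suc d) ] 1
      ≡⟨ ∑-concatMap (λ a → L.map (a ∷_) (allVecs p d)) (allFin p) _ ⟩
    ∑[ a ← allFin p ] ∑[ _ ← L.map (a ∷_) (allVecs p d) ] 1
      ≡⟨ ∑-cong (allFin p) (λ a → trans (∑-1 (L.map (a ∷_) (allVecs p d)))
                                    (trans (length-map (a ∷_) (allVecs p d)) (length-allVecs d))) ⟩
    ∑[ _ ← allFin p ] p ^ d
      ≡⟨ ∑-const (allFin p) (p ^ d) ⟩
    length (allFin p) * p ^ d
      ≡⟨ cong (_* p ^ d) (length-tabulate {n = p} (λ i → i)) ⟩
    p ^ suc d ∎
    where open ≡-Reasoning

  toℕ-mod : (a : Fin p) → toℕ a mod p ≡ a
  toℕ-mod a = trans (fromℕ<-cong _ _ (m<n⇒m%n≡m (toℕ<n a)) _ (toℕ<n a)) (fromℕ<-toℕ a _)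

  vadd-identityˡ : ∀ {d} (x : Vect p d) → vadd p d (zeroV p d) x ≡ x
  vadd-identityˡ []       = refl
  vadd-identityˡ (a ∷ x) = cong₂ _∷_ (toℕ-mod a) (vadd-identityˡ x)

  vadd-identityʳ : ∀ {d} (x : Vect p d) → vadd p d x (zeroV p d) ≡ x
  vadd-identityʳ []       = refl
  vadd-identityʳ (a ∷ x) =
    cong₂ _∷_ (trans (cong (_mod p) (+-identityʳ (toℕ a))) (toℕ-mod a)) (vadd-identityʳ x)

  smul-zeroˡ : ∀ {d} (x : Vect p d) → smul p d (zeroₚ p) x ≡ zeroV p d
  smul-zeroˡ []      = refl
  smul-zeroˡ (a ∷ x) = cong (zeroₚ p ∷_) (smul-zeroˡ x)

  linear-zero : ∀ {d} {g : Vect p d → Vect p d} → IsLinear p d g → g (zeroV p d) ≡ zeroV p d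
  linear-zero {d} {g} (_ , g-homogeneous) = begin
    g (zeroV p d)                          ≡⟨ cong g (smul-zeroˡ (zeroV p d)) ⟨
    g (smul p d (zeroₚ p) (zeroV p d))     ≡⟨ g-homogeneous (zeroₚ p) (zeroV p d) ⟩
    smul p d (zeroₚ p) (g (zeroV p d))     ≡⟨ smul-zeroˡ (g (zeroV p d)) ⟩
    zeroV p d                              ∎
    where open ≡-Reasoning

∣-gcdList : ∀ {h n cs} → h ∣ n → All (h ∣_) cs → h ∣ gcdList n cs
∣-gcdList h∣n []            = h∣n
∣-gcdList h∣n (h∣c ∷ h∣cs) = gcd-greatest h∣c (∣-gcdList h∣n h∣cs)

module Orbits (q d : ℕ) {gs : List (Vect (suc q) d → Vect (suc q) d)} (G₀ : IsLinearGroup (suc q) d gs) where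

  open Vectors q

  o : Vect p d
  o = zeroV p d

  linear : ∀ {g} → g ∈ gs → IsLinear p d g
  linear g∈gs = proj₁ (proj₁ G₀ _ g∈gs)

  bijective : ∀ {g} → g ∈ gs → Bijective _≡_ _≡_ g
  bijective g∈gs = proj₂ (proj₁ G₀ _ g∈gs)

  orbit : Vect p d → Vect p d → Bool
  orbit u y = any (λ g → ⌊ _≟V_ p d (g u) y ⌋) gs

  orbit⁺ : ∀ {u y g} → g ∈ gs → g u ≡ y → orbit u y ≡ true
  orbit⁺ g∈gs gu≡y = Equivalence.to T-≡ (any⁺ _ (lose g∈gs (fromWitness gu≡y)))

  orbit⁻ : ∀ {u y} → orbit u y ≡ true → ∃ λ g → g ∈ gs × g u ≡ y
  orbit⁻ {u} {y} u~y with find (any⁻ _ gs (Equivalence.from T-≡ u~y))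
  ... | g , g∈gs , gu≟y = g , g∈gs , toWitness gu≟y

  orbit-closed : ∀ u {g} → g ∈ gs → ∀ z → orbit u z ≡ true → orbit u (g z) ≡ true
  orbit-closed u {g} g∈gs z u~z with orbit⁻ u~z
  ... | f , f∈gs , fu≡z with find (proj₂ (proj₂ G₀) g f g∈gs f∈gs)
  ...   | g∘f , g∘f∈gs , g∘f≗ = orbit⁺ g∘f∈gs (trans (g∘f≗ u) (cong g fu≡z))

  orbit-∌-o : ∀ {u} → u ≢ o → orbit u o ≡ false
  orbit-∌-o {u} u≢o = ¬-not λ u~o → let g , g∈gs , gu≡o = orbit⁻ u~o in
    u≢o (proj₁ (bijective g∈gs) (trans gu≡o (sym (linear-zero (linear g∈gs)))))

  -- An element x ↦ g x + t of T:G₀ fixing o has t = o.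
  stabiliser-maps-blocks : ∀ {b} {B : Fin b → Vect p d → Bool} → FlagTransitive p d B gs →
    ∀ {i j} → B i o ≡ true → B j o ≡ true → ∃ λ g → g ∈ gs × (∀ z → B j (g z) ≡ B i z)
  stabiliser-maps-blocks {B = B} flag-transitive {i} {j} Bio Bjo with flag-transitive o i o j Bio Bjo
  ... | g , g∈gs , t , go+t≡o , maps = g , g∈gs , λ z → trans (cong (B j) (sym (aff≡g z))) (maps z)
    where
    t≡o : t ≡ o
    t≡o = trans (sym (vadd-identityˡ t))
                (trans (cong (λ x → vadd p d x t) (sym (linear-zero (linear g∈gs)))) go+t≡o)
    aff≡g : ∀ z → aff p d g t z ≡ g z
    aff≡g z = trans (cong (vadd p d (g z)) t≡o) (vadd-identityʳ (g z))

  r∣lam*orbitLength : ∀ {b k r lam} {B : Fin b → Vect p d → Bool} →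
    Is2Design p d b k lam B → ReplicationNumber p d b r B → FlagTransitive p d B gs → 0 < r →
    ∀ u → u ≢ o → r ∣ lam * orbitLength p d gs u
  r∣lam*orbitLength {r = r} {lam} {B} (_ , block-size , balance) replication flag-transitive 0<r u u≢o =
    divides (meet (orbit u) i₀) (begin
      lam * orbitLength p d gs u  ≡⟨ cong (lam *_) (count≡∑ (orbit u) (allVecs p d)) ⟩
      lam * size (orbit u)        ≡⟨ flag-count-uniform o (orbit u) (orbit-∌-o u≢o) i₀ uniform ⟩
      r * meet (orbit u) i₀       ≡⟨ *-comm r _ ⟩
      meet (orbit u) i₀ * r       ∎)
    where
    open ≡-Reasoning
    open Design (_≟V_ p d) (allVecs p d) (allVecs-enumerates d) B block-size replication balance
    i₀ : Fin _
    i₀ = proj₁ (block-through o 0<r)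
    Bi₀o : B i₀ o ≡ true
    Bi₀o = proj₂ (block-through o 0<r)
    meet-mono : ∀ {i j} → B i o ≡ true → B j o ≡ true → meet (orbit u) i ≤ meet (orbit u) j
    meet-mono Bio Bjo with stabiliser-maps-blocks flag-transitive Bio Bjo
    ... | g , g∈gs , maps = meet-≤ (orbit u) (bijective g∈gs) (orbit-closed u g∈gs) maps
    uniform : ∀ i → B i o ≡ true → meet (orbit u) i ≡ meet (orbit u) i₀
    uniform i Bio = ≤-antisym (meet-mono Bio Bi₀o) (meet-mono Bi₀o Bio)

lemma2p4 : (p d : ℕ) .{{_ : NonZero p}} → Prime p
    → (b k r : ℕ) (B : Fin b → Vect p d → Bool) (gs : List (Vect p d → Vect p d))
    → Is2Design p d b k 2 B → 2 < k → k < p ^ d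
    → ReplicationNumber p d b r B
    → IsLinearGroup p d gs → Irreducible p d gs
    → PreservesDesign p d B gs → FlagTransitive p d B gs → PointPrimitive p d gs
    → 2 ∣ r
    → (2 * p ^ d < r * r) × ((r / 2) ∣ orbitGcd p d gs)
lemma2p4 (suc q) d _ b k r B gs design@(_ , block-size , balance) 2<k k<v replication G₀ _ _ flag-transitive _
         (divides h r≡h*2) =
  lam*v<r*r {v = p ^ d} rep k≤r 2<r ,
  subst (_∣ orbitGcd p d gs) (sym r/2≡h) (∣-gcdList h∣p^d∸1 (map⁺ h∣orbits))
  where
  open Vectors q
  open Orbits q d G₀
  open Design (_≟V_ p d) (allVecs p d) (allVecs-enumerates d) B block-size replication balance
  rep : r * k + 2 ≡ 2 * p ^ d + r
  rep = trans (replication-identity o) (cong (λ n → 2 * n + r) (length-allVecs d))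
  2<r : 2 < r
  2<r = lam<r {v = p ^ d} (s≤s z≤n) (≤-trans (s≤s z≤n) 2<k) k<v rep
  k≤r : k ≤ r
  k≤r = fisher o (s≤s z≤n) 2<r
  r/2≡h : r / 2 ≡ h
  r/2≡h = trans (cong (_/ 2) r≡h*2) (m*n/n≡m h 2)
  h∣p^d∸1 : h ∣ p ^ d ∸ 1
  h∣p^d∸1 = h∣v∸1 {v = p ^ d} (≤-trans (s≤s z≤n) 2<k)
    (subst (λ r → r * k + 2 ≡ 2 * p ^ d + r) r≡h*2 rep)
  h∣orbit : ∀ u → u ≢ o → h ∣ orbitLength p d gs u
  h∣orbit u u≢o = *-cancelˡ-∣ 2 (subst (_∣ 2 * orbitLength p d gs u) (trans r≡h*2 (*-comm h 2))
    (r∣lam*orbitLength design replication flag-transitive (<-trans (s≤s z≤n) 2<r) u u≢o))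
  h∣orbits : All (λ u → h ∣ orbitLength p d gs u) (nonzeroVecs p d)
  h∣orbits = All.map (h∣orbit _ ∘ toWitnessFalse) (all-filter _ (allVecs p d))
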